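{- Let $F$ be a recursively enumerable formal system in which infinitely many different theorems can be proved, and let $\mathcal{G}_F$ be as in the context. Then $F$ is consistent if and only if $\mathcal{G}_F$ does not have an infinite Littlestone tree.
   Context: Let $\mathbb{N}=\{0,1,2,\dots\}$. A formal system $F$ is consistent if no well-formed statement is provable together with its negation. Fix a Gödel numbering in which translating statements and forming negations is primitive recursive; theorems are different iff their Gödel numbers differ. $F$ is recursively enumerable if there is a primitive recursive $\varphi:\mathbb{N}\to\mathbb{N}$ whose range is exactly the set of Gödel numbers of statements provable in $F$; fix such $\varphi$. Let $E^2:\mathbb{N}\to\mathbb{N}\times\mathbb{N}$ be a bijection with primitive recursive components $E^2_1,E^2_2$ and primitive recursive inverse. Let $c_c(\{0,1\})$ be the set of finitely supported $a:\mathbb{N}\to\{0,1\}$. For such $a$ let $g_a(n)=a(n)$ if the statement with Gödel number $\varphi(E^2_1(n))$ is the negation of the statement with Gödel number $\varphi(E^2_2(n))$, and $g_a(n)=0$ otherwise; $\mathcal{G}_F=\{g_a: a\in c_c(\{0,1\})\}$. A family $\{x_{\mathbf v}\}_{\mathbf v\in\{0,1\}^k, 0\le k<d}$ indexed by nodes of a complete binary tree is a Littlestone tree of depth $d\le\infty$ of $\mathcal{G}$ if for every $y_1,y_2,\dots\in\{0,1\}$ and every $0\le n<d$ there is $g\in\mathcal{G}$ with $g(x_{y_1\dots y_k})=y_{k+1}$ for all $0\le k\le n$; an infinite Littlestone tree is one of depth $\infty$. -}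

module Defs where

open import Data.Nat using (ℕ; zero; suc; _≤_; _≟_)
open import Data.Bool using (Bool; true; false)
open import Data.Fin using (Fin)
open import Data.Vec using (Vec; []; _∷_; lookup; map)
open import Data.List using (List; []; _∷_)
open import Data.Product using (Σ; ∃; _×_; _,_)
open import Relation.Nullary using (¬_; does)
open import Relation.Binary.PropositionalEquality using (_≡_)

data PR : ℕ → Set where
  pzero : PR 0
  psucc : PR 1
  proj  : ∀ {k} → Fin k → PR k
  comp  : ∀ {k m} → PR m → Vec (PR k) m → PR k
  prec  : ∀ {k} → PR k → PR (suc (suc k)) → PR (suc k)

mutual
  evalPR : ∀ {k} → PR k → Vec ℕ k → ℕ
  evalPR pzero xs = 0
  evalPR psucc (x ∷ []) = suc x
  evalPR (proj i) xs = lookup xs i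
  evalPR (comp f gs) xs = evalPR f (evalAll gs xs)
  evalPR (prec f g) (zero ∷ xs) = evalPR f xs
  evalPR (prec f g) (suc n ∷ xs) = evalPR g (n ∷ evalPR (prec f g) (n ∷ xs) ∷ xs)

  evalAll : ∀ {k m} → Vec (PR k) m → Vec ℕ k → Vec ℕ m
  evalAll [] xs = []
  evalAll (g ∷ gs) xs = evalPR g xs ∷ evalAll gs xs

PrimRec₁ : (ℕ → ℕ) → Set
PrimRec₁ f = Σ (PR 1) λ c → ∀ x → evalPR c (x ∷ []) ≡ f x

PrimRec₂ : (ℕ → ℕ → ℕ) → Set
PrimRec₂ f = Σ (PR 2) λ c → ∀ x y → evalPR c (x ∷ y ∷ []) ≡ f x y

-- Formal systems, presented through their Gödel numbers.

record FormalSystem : Set₁ where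
  field
    WF          : ℕ → Set
    Provable    : ℕ → Set
    neg         : ℕ → ℕ
    neg-primrec : PrimRec₁ neg
    neg-WF      : ∀ s → WF s → WF (neg s)
    prov-WF     : ∀ s → Provable s → WF s
    explosion   : ∀ s t → WF s → Provable s → Provable (neg s) → WF t → Provable t

open FormalSystem public

Consistent : FormalSystem → Set
Consistent F = ¬ (Σ ℕ λ s → WF F s × Provable F s × Provable F (neg F s))

InfinitelyManyTheorems : FormalSystem → Set
InfinitelyManyTheorems F = ∀ N → Σ ℕ λ s → N ≤ s × Provable F s

-- φ witnesses that F is recursively enumerable
Enumerates : FormalSystem → (ℕ → ℕ) → Set
Enumerates F φ = PrimRec₁ φ × (∀ s → Provable F s → Σ ℕ λ k → φ k ≡ s)
                             × (∀ k → Provable F (φ k))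

-- E² : ℕ → ℕ × ℕ bijection with primitive recursive components/inverse
record PairingBijection : Set where
  field
    E₁ E₂    : ℕ → ℕ
    Einv     : ℕ → ℕ → ℕ
    E₁-pr    : PrimRec₁ E₁
    E₂-pr    : PrimRec₁ E₂
    Einv-pr  : PrimRec₂ Einv
    inv-l    : ∀ n → Einv (E₁ n) (E₂ n) ≡ n
    inv-r₁   : ∀ i j → E₁ (Einv i j) ≡ i
    inv-r₂   : ∀ i j → E₂ (Einv i j) ≡ j

open PairingBijection public

FinSupp : (ℕ → Bool) → Set
FinSupp a = Σ ℕ λ N → ∀ n → N ≤ n → a n ≡ false

gA : (F : FormalSystem) (φ : ℕ → ℕ) (E : PairingBijection) → (ℕ → Bool) → ℕ → Bool
gA F φ E a n with φ (E₁ E n) ≟ neg F (φ (E₂ E n))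
... | Relation.Nullary.yes _ = a n
... | Relation.Nullary.no  _ = false

InG : (F : FormalSystem) (φ : ℕ → ℕ) (E : PairingBijection) → (ℕ → Bool) → Set
InG F φ E g = Σ (ℕ → Bool) λ a → FinSupp a × (∀ n → g n ≡ gA F φ E a n)

-- first k bits y₁ … y_k of y (y 0 = y₁)
prefix : (ℕ → Bool) → ℕ → List Bool
prefix y zero = []
prefix y (suc k) = Data.List._∷ʳ_ (prefix y k) (y k)

-- x indexed by nodes (finite binary strings) is an infinite Littlestone tree of 𝒢
InfiniteLittlestoneTree : ((ℕ → Bool) → Set) → (List Bool → ℕ) → Set
InfiniteLittlestoneTree 𝒢 x =
  ∀ (y : ℕ → Bool) (n : ℕ) →
    Σ (ℕ → Bool) λ g → 𝒢 g × (∀ k → k ≤ n → g (x (prefix y k)) ≡ y k)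

HasInfiniteLittlestoneTree : ((ℕ → Bool) → Set) → Set
HasInfiniteLittlestoneTree 𝒢 = Σ (List Bool → ℕ) λ x → InfiniteLittlestoneTree 𝒢 x

module Submission where

-- If F is consistent, no index n pairs a theorem with the negation of a theorem, so
-- every g ∈ 𝒢_F vanishes identically and already the root of a Littlestone tree
-- cannot be labelled 1.  If F is inconsistent, every statement is provable; taking
-- infinitely many distinct theorems t₀, t₁, … and the index h k of the pair
-- (¬ t_k, t_k), the points h k are distinct and g_a(h k) = a(h k) for all a, so any
-- finite labelling of them is realised by a finitely supported a.  Placing h k at
-- every node of depth k gives an infinite Littlestone tree.

open import Defs
open import Data.Bool using (Bool; true; false)
open import Data.Empty using (⊥-elim)
open import Data.List using (length)
open import Data.List.Properties using (length-++)
open import Data.Nat using (ℕ; zero; suc; _+_; _≤_; _<_; _≟_; _⊔_; z≤n; s≤s)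
open import Data.Nat.Properties
open import Data.Product using (Σ; _×_; _,_; proj₁; proj₂)
open import Data.Sum using (inj₁; inj₂)
open import Function using (_∘_)
open import Function.Definitions using (Injective)
open import Relation.Binary.Definitions using (tri<; tri≈; tri>)
open import Relation.Binary.PropositionalEquality
open import Relation.Nullary using (¬_; yes; no)

module UnboundedSequence {P : ℕ → Set} (unbounded : ∀ N → Σ ℕ λ s → N ≤ s × P s) where

  seq : ℕ → ℕ
  seq zero = proj₁ (unbounded 0)
  seq (suc k) = proj₁ (unbounded (suc (seq k)))

  seq-∈ : ∀ k → P (seq k)
  seq-∈ zero = proj₂ (proj₂ (unbounded 0))
  seq-∈ (suc k) = proj₂ (proj₂ (unbounded (suc (seq k))))

  seq-<-suc : ∀ k → seq k < seq (suc k)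
  seq-<-suc k = proj₁ (proj₂ (unbounded (suc (seq k))))

  seq-strictlyMonotone : ∀ {i j} → i < j → seq i < seq j
  seq-strictlyMonotone {i} {suc j} (s≤s i≤j) with m≤n⇒m<n∨m≡n i≤j
  ... | inj₁ i<j = <-trans (seq-strictlyMonotone i<j) (seq-<-suc j)
  ... | inj₂ refl = seq-<-suc i

  seq-injective : Injective _≡_ _≡_ seq
  seq-injective {i} {j} eq with <-cmp i j
  ... | tri< i<j _ _ = ⊥-elim (<⇒≢ (seq-strictlyMonotone i<j) eq)
  ... | tri≈ _ i≡j _ = i≡j
  ... | tri> _ _ j<i = ⊥-elim (<⇒≢ (seq-strictlyMonotone j<i) (sym eq))

module Interpolation (h : ℕ → ℕ) (y : ℕ → Bool) where

  interpolate : ℕ → ℕ → Bool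
  interpolate zero m with h 0 ≟ m
  ... | yes _ = y 0
  ... | no _ = false
  interpolate (suc n) m with h (suc n) ≟ m
  ... | yes _ = y (suc n)
  ... | no _ = interpolate n m

  interpolate-at : Injective _≡_ _≡_ h → ∀ {n k} → k ≤ n → interpolate n (h k) ≡ y k
  interpolate-at h-inj {zero} {zero} z≤n with h 0 ≟ h 0
  ... | yes _ = refl
  ... | no h0≢h0 = ⊥-elim (h0≢h0 refl)
  interpolate-at h-inj {suc n} {k} k≤1+n with h (suc n) ≟ h k
  ... | yes hn≡hk = cong y (h-inj hn≡hk)
  ... | no hn≢hk with m≤n⇒m<n∨m≡n k≤1+n
  ...   | inj₁ k<1+n = interpolate-at h-inj (≤-pred k<1+n)
  ...   | inj₂ refl = ⊥-elim (hn≢hk refl)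

  interpolate-outside : ∀ n m → (∀ k → k ≤ n → h k ≢ m) → interpolate n m ≡ false
  interpolate-outside zero m miss with h 0 ≟ m
  ... | yes h0≡m = ⊥-elim (miss 0 z≤n h0≡m)
  ... | no _ = refl
  interpolate-outside (suc n) m miss with h (suc n) ≟ m
  ... | yes hn≡m = ⊥-elim (miss (suc n) ≤-refl hn≡m)
  ... | no _ = interpolate-outside n m (λ k k≤n → miss k (m≤n⇒m≤1+n k≤n))

  maxUpTo : ℕ → ℕ
  maxUpTo zero = h 0
  maxUpTo (suc n) = h (suc n) ⊔ maxUpTo n

  ≤-maxUpTo : ∀ {n k} → k ≤ n → h k ≤ maxUpTo n
  ≤-maxUpTo {zero} z≤n = ≤-refl
  ≤-maxUpTo {suc n} k≤1+n with m≤n⇒m<n∨m≡n k≤1+n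
  ... | inj₁ k<1+n = m≤n⇒m≤o⊔n (h (suc n)) (≤-maxUpTo (≤-pred k<1+n))
  ... | inj₂ refl = m≤m⊔n (h (suc n)) (maxUpTo n)

  interpolate-finSupp : ∀ n → FinSupp (interpolate n)
  interpolate-finSupp n = suc (maxUpTo n) , λ m bound≤m →
    interpolate-outside n m λ k k≤n hk≡m →
      <⇒≱ (s≤s (≤-maxUpTo k≤n)) (subst (suc (maxUpTo n) ≤_) (sym hk≡m) bound≤m)

length-prefix : ∀ y k → length (prefix y k) ≡ k
length-prefix y zero = refl
length-prefix y (suc k) = begin
  length (prefix y (suc k)) ≡⟨ length-++ (prefix y k) ⟩
  length (prefix y k) + 1   ≡⟨ +-comm (length (prefix y k)) 1 ⟩
  suc (length (prefix y k)) ≡⟨ cong suc (length-prefix y k) ⟩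
  suc k ∎
  where open ≡-Reasoning

module _ (F : FormalSystem) (φ : ℕ → ℕ) (E : PairingBijection) where

  IsContradiction : ℕ → Set
  IsContradiction n = φ (E₁ E n) ≡ neg F (φ (E₂ E n))

  gA-contradiction : ∀ a {n} → IsContradiction n → gA F φ E a n ≡ a n
  gA-contradiction a {n} clash with φ (E₁ E n) ≟ neg F (φ (E₂ E n))
  ... | yes _ = refl
  ... | no ¬clash = ⊥-elim (¬clash clash)

  gA-noContradiction : ∀ a {n} → ¬ IsContradiction n → gA F φ E a n ≡ false
  gA-noContradiction a {n} ¬clash with φ (E₁ E n) ≟ neg F (φ (E₂ E n))
  ... | yes clash = ⊥-elim (¬clash clash)
  ... | no _ = refl

  contradiction⇒inconsistent : (∀ k → Provable F (φ k)) → ∀ {n} → IsContradiction n → ¬ Consistent F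
  contradiction⇒inconsistent φ-provable {n} clash consistent =
    consistent (φ (E₂ E n) , prov-WF F _ (φ-provable (E₂ E n)) , φ-provable (E₂ E n)
               , subst (Provable F) clash (φ-provable (E₁ E n)))

  consistent⇒InG-false : (∀ k → Provable F (φ k)) → Consistent F →
                         ∀ {g} → InG F φ E g → ∀ n → g n ≡ false
  consistent⇒InG-false φ-provable consistent (a , _ , g≡gA) n =
    trans (g≡gA n) (gA-noContradiction a λ clash →
      contradiction⇒inconsistent φ-provable clash consistent)

  consistent⇒noInfiniteLittlestoneTree : (∀ k → Provable F (φ k)) → Consistent F →
                                         ¬ HasInfiniteLittlestoneTree (InG F φ E)
  consistent⇒noInfiniteLittlestoneTree φ-provable consistent (x , tree)
    with tree (λ _ → true) 0
  ... | g , g∈𝒢 , g-labels with trans (sym (g-labels 0 z≤n))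
                                      (consistent⇒InG-false φ-provable consistent g∈𝒢 (x _))
  ... | ()

  contradictions⇒infiniteLittlestoneTree : (h : ℕ → ℕ) → Injective _≡_ _≡_ h →
    (∀ k → IsContradiction (h k)) → HasInfiniteLittlestoneTree (InG F φ E)
  contradictions⇒infiniteLittlestoneTree h h-inj clash = (λ node → h (length node)) , tree
    where
    open Interpolation h

    tree : InfiniteLittlestoneTree (InG F φ E) (λ node → h (length node))
    tree y n = gA F φ E a , (a , interpolate-finSupp y n , λ _ → refl) , labels
      where
      a : ℕ → Bool
      a = interpolate y n

      labels : ∀ k → k ≤ n → gA F φ E a (h (length (prefix y k))) ≡ y k
      labels k k≤n = begin
        gA F φ E a (h (length (prefix y k))) ≡⟨ cong (λ d → gA F φ E a (h d)) (length-prefix y k) ⟩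
        gA F φ E a (h k)                     ≡⟨ gA-contradiction a (clash k) ⟩
        a (h k)                              ≡⟨ interpolate-at y h-inj k≤n ⟩
        y k                                  ∎
        where open ≡-Reasoning

  Inconsistent : Set
  Inconsistent = Σ ℕ λ s → WF F s × Provable F s × Provable F (neg F s)

  inconsistent⇒injectiveContradictions : Enumerates F φ → InfinitelyManyTheorems F → Inconsistent →
    Σ (ℕ → ℕ) λ h → Injective _≡_ _≡_ h × (∀ k → IsContradiction (h k))
  inconsistent⇒injectiveContradictions (_ , enumerated , _) infinite (s , wf-s , ⊢s , ⊢¬s) =
    h , h-injective , h-contradiction
    where
    open UnboundedSequence infinite renaming (seq to t; seq-∈ to ⊢t)

    index : ∀ u → Provable F u → ℕ
    index u ⊢u = proj₁ (enumerated u ⊢u)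

    φ-index : ∀ u ⊢u → φ (index u ⊢u) ≡ u
    φ-index u ⊢u = proj₂ (enumerated u ⊢u)

    ⊢¬t : ∀ k → Provable F (neg F (t k))
    ⊢¬t k = explosion F s _ wf-s ⊢s ⊢¬s (neg-WF F _ (prov-WF F _ (⊢t k)))

    h : ℕ → ℕ
    h k = Einv E (index _ (⊢¬t k)) (index _ (⊢t k))

    φE₂h : ∀ k → φ (E₂ E (h k)) ≡ t k
    φE₂h k = trans (cong φ (inv-r₂ E _ _)) (φ-index _ (⊢t k))

    h-contradiction : ∀ k → IsContradiction (h k)
    h-contradiction k = begin
      φ (E₁ E (h k))          ≡⟨ cong φ (inv-r₁ E _ _) ⟩
      φ (index _ (⊢¬t k))     ≡⟨ φ-index _ (⊢¬t k) ⟩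
      neg F (t k)             ≡⟨ cong (neg F) (sym (φE₂h k)) ⟩
      neg F (φ (E₂ E (h k)))  ∎
      where open ≡-Reasoning

    h-injective : Injective _≡_ _≡_ h
    h-injective {i} {j} hi≡hj =
      seq-injective (trans (sym (φE₂h i)) (trans (cong (φ ∘ E₂ E) hi≡hj) (φE₂h j)))

proposition4p9 : (F : FormalSystem) (φ : ℕ → ℕ) (E : PairingBijection) →
    Enumerates F φ → InfinitelyManyTheorems F →
    (Consistent F → ¬ HasInfiniteLittlestoneTree (InG F φ E)) ×
    (¬ HasInfiniteLittlestoneTree (InG F φ E) → Consistent F)
proposition4p9 F φ E enumerates infinite =
  consistent⇒noInfiniteLittlestoneTree F φ E (proj₂ (proj₂ enumerates)) ,
  λ noTree inconsistent →
    let h , h-injective , h-contradiction =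
          inconsistent⇒injectiveContradictions F φ E enumerates infinite inconsistent
    in noTree (contradictions⇒infiniteLittlestoneTree F φ E h h-injective h-contradiction)
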